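{- Let $G$ be a finite, connected, undirected multigraph without loops with $n$ vertices and reduced Laplacian $\tilde L$, and let $C^{\tilde L}=(\det\tilde L)\tilde L^{ -1}$. For every $D\in\mathrm{Div}^0(G)$, the order of $[D]$ in $\mathrm{Jac}(G)$ equals $\det\tilde L/\gcd(C^{\tilde L}\tilde D,\det\tilde L)$, where $\gcd(C^{\tilde L}\tilde D,\det\tilde L)$ is the greatest common divisor of all entries of the vector $C^{\tilde L}\tilde D$ together with $\det\tilde L$.
   Context: Vertices are indexed $v_1,\dots,v_n$. A divisor is a vector in $\mathbb{Z}^n$; $\mathrm{Div}^0(G)$ is the group of divisors with entry sum $0$; $\tilde D$ is $D$ with its $n$-th entry deleted. The Laplacian is $L=\Delta-A$ ($\Delta$ diagonal of valencies, $A_{ij}$ the number of edges between $v_i,v_j$); $\tilde L$ is $L$ with the $n$-th row and column deleted; $\det\tilde L=|\mathrm{Jac}(G)|>0$ and $C^{\tilde L}$ is the integer cofactor matrix of $\tilde L$. $\mathrm{Jac}(G)=\mathrm{Div}^0(G)/\{L\sigma:\sigma\in\mathbb{Z}^n\}$. -}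

module Defs where

open import Data.Nat as ℕ using (ℕ; zero; suc; NonZero)
import Data.Nat.DivMod as DM
open import Data.Nat.GCD using (gcd)
open import Data.Integer as ℤ using (ℤ; +_; ∣_∣)
open import Data.Fin using (Fin; zero; suc; toℕ; inject₁; punchIn)
open import Data.Product using (Σ; ∃; _×_; _,_)
open import Relation.Binary.PropositionalEquality using (_≡_)
open import Relation.Nullary using (¬_)

-- A loopless finite multigraph on vertices Fin n, given by its adjacency
-- matrix: A i j = number of edges between v_i and v_j.
record Multigraph (n : ℕ) : Set where
  field
    adj       : Fin n → Fin n → ℕ
    symmetric : ∀ i j → adj i j ≡ adj j i
    loopless  : ∀ i → adj i i ≡ 0
open Multigraph public

Σℕ : ∀ {n} → (Fin n → ℕ) → ℕ
Σℕ {zero}  f = 0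
Σℕ {suc n} f = f zero ℕ.+ Σℕ (λ i → f (suc i))

Σℤ : ∀ {n} → (Fin n → ℤ) → ℤ
Σℤ {zero}  f = + 0
Σℤ {suc n} f = f zero ℤ.+ Σℤ (λ i → f (suc i))

data Reachable {n} (G : Multigraph n) (i : Fin n) : Fin n → Set where
  here : Reachable G i i
  step : ∀ {j k} → Reachable G i j → 0 ℕ.< adj G j k → Reachable G i k

Connected : ∀ {n} → Multigraph n → Set
Connected G = ∀ i j → Reachable G i j

Matrix : ℕ → Set
Matrix n = Fin n → Fin n → ℤ

valency : ∀ {n} → Multigraph n → Fin n → ℕ
valency G i = Σℕ (adj G i)

δ : ∀ {n} → Fin n → Fin n → ℕ
δ zero zero = 1
δ zero (suc j) = 0
δ (suc i) zero = 0
δ (suc i) (suc j) = δ i j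

laplacian : ∀ {n} → Multigraph n → Matrix n
laplacian G i j = (+ (δ i j ℕ.* valency G i)) ℤ.- (+ adj G i j)

reducedLaplacian : ∀ {m} → Multigraph (suc m) → Matrix m
reducedLaplacian G i j = laplacian G (inject₁ i) (inject₁ j)

reduce : ∀ {m} → (Fin (suc m) → ℤ) → Fin m → ℤ
reduce D i = D (inject₁ i)

sgn : ℕ → ℤ
sgn zero = + 1
sgn (suc k) = ℤ.- sgn k

minor : ∀ {n} → Fin (suc n) → Fin (suc n) → Matrix (suc n) → Matrix n
minor i j M a b = M (punchIn i a) (punchIn j b)

det : ∀ {n} → Matrix n → ℤ
det {zero}  M = + 1
det {suc n} M = Σℤ (λ j → sgn (toℕ j) ℤ.* (M zero j ℤ.* det (minor zero j M)))

-- C^M = adjugate = (det M) M^{-1}:  C i j = (-1)^(i+j) det(minor j i)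
cofactorMatrix : ∀ {n} → Matrix n → Matrix n
cofactorMatrix {zero}  M ()
cofactorMatrix {suc n} M i j = sgn (toℕ i ℕ.+ toℕ j) ℤ.* det (minor j i M)

_·ᵥ_ : ∀ {n} → Matrix n → (Fin n → ℤ) → Fin n → ℤ
(M ·ᵥ v) i = Σℤ (λ j → M i j ℤ.* v j)

gcdWith : ∀ {n} → (Fin n → ℤ) → ℤ → ℕ
gcdWith {zero}  v d = ∣ d ∣
gcdWith {suc n} v d = gcd ∣ v zero ∣ (gcdWith (λ i → v (suc i)) d)

-- natural-number division (convention a / 0 = 0; irrelevant when b > 0)
_div_ : ℕ → ℕ → ℕ
a div zero = 0
a div (suc b) = DM._/_ a (suc b)

Divisor : ℕ → Set
Divisor n = Fin n → ℤ

IsDegreeZero : ∀ {n} → Divisor n → Set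
IsDegreeZero D = Σℤ D ≡ + 0

-- D is principal (zero in Jac(G)): D = L σ for some σ ∈ ℤ^n
IsPrincipal : ∀ {n} → Multigraph n → Divisor n → Set
IsPrincipal G D = Σ (Fin _ → ℤ) λ σ → ∀ i → D i ≡ (laplacian G ·ᵥ σ) i

scale : ∀ {n} → ℕ → Divisor n → Divisor n
scale k D i = (+ k) ℤ.* D i

OrderInJac : ∀ {n} → Multigraph n → Divisor n → ℕ → Set
OrderInJac G D k =
  (0 ℕ.< k) × IsPrincipal G (scale k D)
  × (∀ j → 0 ℕ.< j → j ℕ.< k → ¬ IsPrincipal G (scale j D))

-- A degree-zero divisor E is principal iff its reduction Ẽ is L̃τ for an integer vector τ: one may
-- shift the potential σ so that it vanishes at vₙ (L kills constants), and the n-th equation follows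
-- from the others because both sides have degree zero. By the maximum principle on the connected
-- graph, every leading principal submatrix of L̃ has trivial kernel, so det L̃ ≠ 0; then, since
-- L̃ C^L̃ = (det L̃) I, the system L̃τ = kD̃ is solvable iff det L̃ divides every entry of k C^L̃ D̃,
-- i.e. iff |det L̃| divides k · gcd(C^L̃ D̃, det L̃), i.e. iff det L̃ / gcd(C^L̃ D̃, det L̃) divides k.

module Submission where

open import Defs
open import Data.Nat as ℕ using (ℕ; zero; suc)
import Data.Nat.Properties as ℕP
import Data.Nat.Divisibility as ℕ∣
open ℕ∣ using (_∣_)
import Data.Nat.DivMod as DM
open import Data.Nat.GCD using (gcd[m,n]∣m; gcd[m,n]∣n; gcd-greatest; c*gcd[m,n]≡gcd[cm,cn])
open import Data.Integer as ℤ using (ℤ; ∣_∣; +_; _+_; _*_; -_; _-_; _≤_; _<_)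
import Data.Integer.Properties as ℤP
import Data.Integer.Divisibility.Signed as ℤ∣
open import Data.Integer.Tactic.RingSolver using (solve-∀)
open import Data.Fin as F using (Fin; zero; suc; toℕ; inject₁; inject≤; fromℕ; punchIn)
import Data.Fin.Properties as FP
open import Data.Fin.Induction using (<-weakInduction)
open import Data.Vec.Functional using (updateAt)
open import Data.Vec.Functional.Properties using (updateAt-updates; updateAt-minimal; updateAt-id-local)
open import Data.Product using (Σ; _,_)
open import Data.Sum using (inj₁; inj₂)
open import Function using (_∘_; const)
open import Function.Bundles using (_⇔_; mk⇔; Equivalence)
open import Function.Properties.Equivalence using (⇔-setoid) renaming (sym to ⇔-sym)
open import Level using (0ℓ)
open import Relation.Binary.PropositionalEquality
  using (_≡_; _≢_; refl; sym; trans; cong; cong₂; subst; module ≡-Reasoning)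
import Relation.Binary.Reasoning.Setoid as SetoidReasoning
open import Relation.Nullary using (¬_; Dec; contradiction; yes; no)
open import Algebra.Properties.AbelianGroup ℤP.+-0-abelianGroup using () renaming (∙-cancelˡ to +-cancelˡ)
open import Algebra.Properties.Semiring.Sum ℤP.+-*-semiring
  using (sum; sum-cong-≗; ∑-distrib-+; ∑-comm; sum-init-last; *-distribˡ-sum; *-distribʳ-sum; sum-remove)

Σℤ≡sum : ∀ {n} (f : Fin n → ℤ) → Σℤ f ≡ sum f
Σℤ≡sum {zero}  f = refl
Σℤ≡sum {suc n} f = cong (_+_ (f zero)) (Σℤ≡sum (f ∘ suc))

Σℤ-cong : ∀ {n} {f g : Fin n → ℤ} → (∀ i → f i ≡ g i) → Σℤ f ≡ Σℤ g
Σℤ-cong {f = f} {g} f≗g = trans (Σℤ≡sum f) (trans (sum-cong-≗ f≗g) (sym (Σℤ≡sum g)))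

Σℤ-zero : ∀ {n} {f : Fin n → ℤ} → (∀ i → f i ≡ + 0) → Σℤ f ≡ + 0
Σℤ-zero {zero}  _   = refl
Σℤ-zero {suc n} f≗0 = cong₂ _+_ (f≗0 zero) (Σℤ-zero (f≗0 ∘ suc))

Σℤ-+ : ∀ {n} (f g : Fin n → ℤ) → Σℤ (λ i → f i + g i) ≡ Σℤ f + Σℤ g
Σℤ-+ f g = trans (Σℤ≡sum (λ i → f i + g i))
  (trans (∑-distrib-+ f g) (sym (cong₂ _+_ (Σℤ≡sum f) (Σℤ≡sum g))))

Σℤ-*ˡ : ∀ {n} a (f : Fin n → ℤ) → Σℤ (λ i → a * f i) ≡ a * Σℤ f
Σℤ-*ˡ a f = trans (Σℤ≡sum (λ i → a * f i))
  (trans (sym (*-distribˡ-sum a f)) (cong (a *_) (sym (Σℤ≡sum f))))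

Σℤ-*ʳ : ∀ {n} a (f : Fin n → ℤ) → Σℤ (λ i → f i * a) ≡ Σℤ f * a
Σℤ-*ʳ a f = trans (Σℤ≡sum (λ i → f i * a))
  (trans (sym (*-distribʳ-sum a f)) (cong (_* a) (sym (Σℤ≡sum f))))

Σℤ-neg : ∀ {n} (f : Fin n → ℤ) → Σℤ (λ i → - f i) ≡ - Σℤ f
Σℤ-neg f = trans (Σℤ-cong (λ i → sym (ℤP.-1*i≡-i (f i))))
  (trans (Σℤ-*ˡ (- + 1) f) (ℤP.-1*i≡-i (Σℤ f)))

Σℤ-comm : ∀ {m n} (f : Fin m → Fin n → ℤ) →
  Σℤ (λ i → Σℤ (f i)) ≡ Σℤ (λ j → Σℤ (λ i → f i j))
Σℤ-comm f = trans (double f) (trans (∑-comm f) (sym (double (λ j i → f i j))))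
  where
  double : ∀ {m n} (g : Fin m → Fin n → ℤ) → Σℤ (λ i → Σℤ (g i)) ≡ sum (λ i → sum (g i))
  double g = trans (Σℤ-cong (λ i → Σℤ≡sum (g i))) (Σℤ≡sum (λ i → sum (g i)))

Σℤ-init-last : ∀ {n} (f : Fin (suc n) → ℤ) → Σℤ f ≡ Σℤ (f ∘ inject₁) + f (fromℕ n)
Σℤ-init-last f = trans (Σℤ≡sum f)
  (trans (sum-init-last f) (cong (_+ f (fromℕ _)) (sym (Σℤ≡sum (f ∘ inject₁)))))

Σℤ-remove : ∀ {n} (i : Fin (suc n)) (f : Fin (suc n) → ℤ) → Σℤ f ≡ f i + Σℤ (f ∘ punchIn i)
Σℤ-remove i f = trans (Σℤ≡sum f)
  (trans (sum-remove f) (cong (_+_ (f i)) (sym (Σℤ≡sum (f ∘ punchIn i)))))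

Σℤ-single : ∀ {n} (i : Fin n) (f : Fin n → ℤ) → (∀ j → j ≢ i → f j ≡ + 0) → Σℤ f ≡ f i
Σℤ-single {suc n} i f f≗0 = begin
  Σℤ f                      ≡⟨ Σℤ-remove i f ⟩
  f i + Σℤ (f ∘ punchIn i)  ≡⟨ cong (_+_ (f i)) (Σℤ-zero (λ j → f≗0 _ (FP.punchInᵢ≢i i j))) ⟩
  f i + + 0                 ≡⟨ ℤP.+-identityʳ (f i) ⟩
  f i                       ∎
  where open ≡-Reasoning

Σℤ-nonneg : ∀ {n} (f : Fin n → ℤ) → (∀ i → + 0 ≤ f i) → + 0 ≤ Σℤ f
Σℤ-nonneg {zero}  f f≥0 = ℤP.≤-refl
Σℤ-nonneg {suc n} f f≥0 = ℤP.+-mono-≤ (f≥0 zero) (Σℤ-nonneg (f ∘ suc) (f≥0 ∘ suc))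

Σℤ-nonneg≡0 : ∀ {n} (f : Fin n → ℤ) → (∀ i → + 0 ≤ f i) → Σℤ f ≡ + 0 → ∀ i → f i ≡ + 0
Σℤ-nonneg≡0 {suc n} f f≥0 Σf≡0 i = ℤP.≤-antisym (begin
  f i                       ≡⟨ ℤP.+-identityʳ (f i) ⟨
  f i + + 0                 ≤⟨ ℤP.+-monoʳ-≤ (f i) (Σℤ-nonneg (f ∘ punchIn i) (f≥0 ∘ punchIn i)) ⟩
  f i + Σℤ (f ∘ punchIn i)  ≡⟨ Σℤ-remove i f ⟨
  Σℤ f                      ≡⟨ Σf≡0 ⟩
  + 0                       ∎)
  (f≥0 i)
  where open ℤP.≤-Reasoning

Σℤ-inject≤ : ∀ {k n} .(k≤n : k ℕ.≤ n) (g : Fin n → ℤ) →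
  (∀ w → k ℕ.≤ toℕ w → g w ≡ + 0) → Σℤ g ≡ Σℤ (λ j → g (inject≤ j k≤n))
Σℤ-inject≤ {zero}  {n}     _   g g≡0 = Σℤ-zero λ w → g≡0 w ℕ.z≤n
Σℤ-inject≤ {suc k} {suc n} k≤n g g≡0 =
  cong (_+_ (g zero)) (Σℤ-inject≤ (ℕ.s≤s⁻¹ k≤n) (g ∘ suc) λ w k≤w → g≡0 (suc w) (ℕ.s≤s k≤w))

+-Σℕ : ∀ {n} (f : Fin n → ℕ) → + Σℕ f ≡ Σℤ (λ i → + f i)
+-Σℕ {zero}  f = refl
+-Σℕ {suc n} f = trans (ℤP.pos-+ (f zero) (Σℕ (f ∘ suc))) (cong (_+_ (+ f zero)) (+-Σℕ (f ∘ suc)))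

·ᵥ-congʳ : ∀ {n} (M : Matrix n) {x y : Fin n → ℤ} → (∀ j → x j ≡ y j) →
  ∀ i → (M ·ᵥ x) i ≡ (M ·ᵥ y) i
·ᵥ-congʳ M x≗y i = Σℤ-cong λ j → cong (_*_ (M i j)) (x≗y j)

·ᵥ-scale : ∀ {n} (M : Matrix n) a (x : Fin n → ℤ) i → (M ·ᵥ (λ j → a * x j)) i ≡ a * (M ·ᵥ x) i
·ᵥ-scale M a x i = trans (Σℤ-cong λ j → reorder (M i j) a (x j)) (Σℤ-*ˡ a (λ j → M i j * x j))
  where
  reorder : ∀ m a x → m * (a * x) ≡ a * (m * x)
  reorder = solve-∀

·ᵥ-neg : ∀ {n} (M : Matrix n) (x : Fin n → ℤ) i → (M ·ᵥ (λ j → - x j)) i ≡ - (M ·ᵥ x) i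
·ᵥ-neg M x i =
  trans (Σℤ-cong λ j → sym (ℤP.neg-distribʳ-* (M i j) (x j))) (Σℤ-neg λ j → M i j * x j)

·ᵥ-sub : ∀ {n} (M : Matrix n) (x y : Fin n → ℤ) i →
  (M ·ᵥ (λ j → x j - y j)) i ≡ (M ·ᵥ x) i - (M ·ᵥ y) i
·ᵥ-sub M x y i = begin
  Σℤ (λ j → M i j * (x j - y j))
    ≡⟨ Σℤ-cong (λ j → distribute (M i j) (x j) (y j)) ⟩
  Σℤ (λ j → M i j * x j + - (M i j * y j))
    ≡⟨ Σℤ-+ (λ j → M i j * x j) (λ j → - (M i j * y j)) ⟩
  (M ·ᵥ x) i + Σℤ (λ j → - (M i j * y j))
    ≡⟨ cong (_+_ ((M ·ᵥ x) i)) (Σℤ-neg (λ j → M i j * y j)) ⟩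
  (M ·ᵥ x) i - (M ·ᵥ y) i ∎
  where
  open ≡-Reasoning
  distribute : ∀ m a b → m * (a - b) ≡ m * a + - (m * b)
  distribute = solve-∀

δ-refl : ∀ {n} (i : Fin n) → δ i i ≡ 1
δ-refl zero    = refl
δ-refl (suc i) = δ-refl i

δ-≢ : ∀ {n} {i j : Fin n} → i ≢ j → δ i j ≡ 0
δ-≢ {i = zero}  {zero}  0≢0 = contradiction refl 0≢0
δ-≢ {i = zero}  {suc j} _   = refl
δ-≢ {i = suc i} {zero}  _   = refl
δ-≢ {i = suc i} {suc j} i≢j = δ-≢ (i≢j ∘ cong suc)

·ᵥ-δ : ∀ {n} (M : Matrix n) i j → (M ·ᵥ (λ k → + δ k j)) i ≡ M i j
·ᵥ-δ M i j = begin
  Σℤ (λ k → M i k * + δ k j)  ≡⟨ Σℤ-single j (λ k → M i k * + δ k j) off-diagonal ⟩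
  M i j * + δ j j             ≡⟨ cong (λ d → M i j * + d) (δ-refl j) ⟩
  M i j * + 1                 ≡⟨ ℤP.*-identityʳ (M i j) ⟩
  M i j                       ∎
  where
  open ≡-Reasoning
  off-diagonal : ∀ k → k ≢ j → M i k * + δ k j ≡ + 0
  off-diagonal k k≢j = trans (cong (λ d → M i k * + d) (δ-≢ k≢j)) (ℤP.*-zeroʳ (M i k))

TrivialKernel : ∀ {n} → Matrix n → Set
TrivialKernel M = ∀ x → (∀ i → (M ·ᵥ x) i ≡ + 0) → ∀ i → x i ≡ + 0

TrivialKernel-cong : ∀ {n} {M N : Matrix n} → (∀ i j → M i j ≡ N i j) →
  TrivialKernel M → TrivialKernel N
TrivialKernel-cong M≗N ker x Nx≡0 =
  ker x λ i → trans (Σℤ-cong λ j → cong (_* x j) (M≗N i j)) (Nx≡0 i)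

leading : ∀ {k n} → .(k ℕ.≤ n) → Matrix n → Matrix k
leading k≤n M i j = M (inject≤ i k≤n) (inject≤ j k≤n)

padZero : ∀ {k n} → (Fin k → ℤ) → Fin n → ℤ
padZero {k} x w with toℕ w ℕ.<? k
... | yes w<k = x (F.fromℕ< w<k)
... | no  _   = + 0

padZero-inject≤ : ∀ {k n} .(k≤n : k ℕ.≤ n) (x : Fin k → ℤ) i →
  padZero x (inject≤ i k≤n) ≡ x i
padZero-inject≤ {k} k≤n x i with toℕ (inject≤ i k≤n) ℕ.<? k
... | yes i<k = cong x (FP.toℕ-injective (trans (FP.toℕ-fromℕ< i<k) (FP.toℕ-inject≤ i k≤n)))
... | no  i≮k = contradiction (subst (ℕ._< k) (sym (FP.toℕ-inject≤ i k≤n)) (FP.toℕ<n i)) i≮k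

padZero-≥ : ∀ {k n} (x : Fin k → ℤ) (w : Fin n) → k ℕ.≤ toℕ w → padZero x w ≡ + 0
padZero-≥ {k} x w k≤w with toℕ w ℕ.<? k
... | yes w<k = contradiction w<k (ℕP.≤⇒≯ k≤w)
... | no  _   = refl

leading-·ᵥ : ∀ {k n} .(k≤n : k ℕ.≤ n) (M : Matrix n) x i →
  (leading k≤n M ·ᵥ x) i ≡ (M ·ᵥ padZero x) (inject≤ i k≤n)
leading-·ᵥ {n = n} k≤n M x i = sym (trans
  (Σℤ-inject≤ k≤n (λ w → row w * padZero x w) λ w k≤w →
    trans (cong (_*_ (row w)) (padZero-≥ x w k≤w)) (ℤP.*-zeroʳ (row w)))
  (Σℤ-cong λ j → cong (_*_ (row (inject≤ j k≤n))) (padZero-inject≤ k≤n x j)))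
  where
  row : Fin n → ℤ
  row = M (inject≤ i k≤n)

-- Determinants and cofactors

det-cong : ∀ {n} {M N : Matrix n} → (∀ i j → M i j ≡ N i j) → det M ≡ det N
det-cong {zero}  M≗N = refl
det-cong {suc n} M≗N = Σℤ-cong λ j →
  cong₂ (λ a b → sgn (toℕ j) * (a * b)) (M≗N zero j) (det-cong (λ a b → M≗N (suc a) (punchIn j b)))

RespectsColumns : ∀ {n m} → ((Fin n → Fin m) → ℤ) → Set
RespectsColumns Ψ = ∀ {σ τ} → (∀ b → σ b ≡ τ b) → Ψ σ ≡ Ψ τ

-- Laplace expansion along two rows u and v, where Ψ σ stands for the determinant of the
-- remaining rows restricted to the columns σ.
expand₂ : ∀ {n} (u v : Fin (suc (suc n)) → ℤ) → ((Fin n → Fin (suc (suc n))) → ℤ) → ℤ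
expand₂ u v Ψ = Σℤ λ j → sgn (toℕ j) * (u j *
  Σℤ λ k → sgn (toℕ k) * (v (punchIn j k) * Ψ (punchIn j ∘ punchIn k)))

det≡expand₂ : ∀ {n} (M : Matrix (suc (suc n))) →
  det M ≡ expand₂ (M zero) (M (suc zero)) (λ σ → det (λ a b → M (suc (suc a)) (σ b)))
det≡expand₂ M = refl

expandSkip₀ : ∀ {n} (u : Fin (suc (suc n)) → ℤ) → ((Fin n → Fin (suc (suc n))) → ℤ) → ℤ
expandSkip₀ u Ψ = Σℤ λ k → sgn (toℕ k) * (u (suc k) * Ψ (suc ∘ punchIn k))

expand₂Skip₀ : ∀ {n} (u v : Fin (suc (suc n)) → ℤ) → ((Fin n → Fin (suc (suc n))) → ℤ) → ℤ
expand₂Skip₀ u v Ψ = Σℤ λ j → (- sgn (toℕ j)) * (u (suc j) * Σℤ λ k →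
  sgn (toℕ (suc k)) * (v (punchIn (suc j) (suc k)) * Ψ (punchIn (suc j) ∘ punchIn (suc k))))

expand₂-split : ∀ {n} u v (Ψ : (Fin n → Fin (suc (suc n))) → ℤ) →
  expand₂ u v Ψ ≡ (u zero * expandSkip₀ v Ψ - expandSkip₀ u Ψ * v zero) + expand₂Skip₀ u v Ψ
expand₂-split {n} u v Ψ = begin
  expand₂ u v Ψ
    ≡⟨ cong (_+_ (+ 1 * (u zero * expandSkip₀ v Ψ))) (Σℤ-cong λ j →
         distribute (sgn (toℕ j)) (u (suc j)) (v zero) (Ψ (suc ∘ punchIn j)) (inner j)) ⟩
  + 1 * (u zero * expandSkip₀ v Ψ) + Σℤ (λ j → - (outer j * v zero) + rest j)
    ≡⟨ cong (_+_ (+ 1 * (u zero * expandSkip₀ v Ψ))) (Σℤ-+ (λ j → - (outer j * v zero)) rest) ⟩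
  + 1 * (u zero * expandSkip₀ v Ψ) + (Σℤ (λ j → - (outer j * v zero)) + expand₂Skip₀ u v Ψ)
    ≡⟨ cong (λ s → + 1 * (u zero * expandSkip₀ v Ψ) + (s + expand₂Skip₀ u v Ψ))
         (trans (Σℤ-neg (λ j → outer j * v zero)) (cong -_ (Σℤ-*ʳ (v zero) outer))) ⟩
  + 1 * (u zero * expandSkip₀ v Ψ) + (- (expandSkip₀ u Ψ * v zero) + expand₂Skip₀ u v Ψ)
    ≡⟨ reassociate (u zero * expandSkip₀ v Ψ) (expandSkip₀ u Ψ * v zero) (expand₂Skip₀ u v Ψ) ⟩
  (u zero * expandSkip₀ v Ψ - expandSkip₀ u Ψ * v zero) + expand₂Skip₀ u v Ψ ∎
  where
  open ≡-Reasoning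
  outer inner rest : Fin (suc n) → ℤ
  outer j = sgn (toℕ j) * (u (suc j) * Ψ (suc ∘ punchIn j))
  inner j = Σℤ λ k → sgn (toℕ (suc k)) *
    (v (punchIn (suc j) (suc k)) * Ψ (punchIn (suc j) ∘ punchIn (suc k)))
  rest j = (- sgn (toℕ j)) * (u (suc j) * inner j)
  distribute : ∀ s a v₀ p x →
    (- s) * (a * (+ 1 * (v₀ * p) + x)) ≡ - (s * (a * p) * v₀) + (- s) * (a * x)
  distribute = solve-∀
  reassociate : ∀ a c r → + 1 * a + (- c + r) ≡ (a - c) + r
  reassociate = solve-∀

expand₂Skip₀-suc : ∀ {n} u v (Ψ : (Fin (suc n) → Fin (suc (suc (suc n)))) → ℤ) →
  RespectsColumns Ψ → expand₂Skip₀ u v Ψ ≡ expand₂ (u ∘ suc) (v ∘ suc) (Ψ ∘ F.lift 1)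
expand₂Skip₀-suc {n} u v Ψ resp = Σℤ-cong λ j → trans
  (cong (λ s → (- sgn (toℕ j)) * (u (suc j) * s)) (trans (Σℤ-cong (negate j)) (Σℤ-neg (term j))))
  (cancelSigns (sgn (toℕ j)) (u (suc j)) (Σℤ (term j)))
  where
  term : Fin (suc (suc n)) → Fin (suc n) → ℤ
  term j k = sgn (toℕ k) * (v (suc (punchIn j k)) * Ψ (F.lift 1 (punchIn j ∘ punchIn k)))
  negate : ∀ j k →
    (- sgn (toℕ k)) * (v (suc (punchIn j k)) * Ψ (punchIn (suc j) ∘ punchIn (suc k))) ≡ - term j k
  negate j k = trans
    (cong (λ p → (- sgn (toℕ k)) * (v (suc (punchIn j k)) * p)) (resp λ { zero → refl ; (suc b) → refl }))
    (sym (ℤP.neg-distribˡ-* (sgn (toℕ k)) _))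
  cancelSigns : ∀ s a x → (- s) * (a * - x) ≡ s * (a * x)
  cancelSigns = solve-∀

-- Splitting off the terms that use column 0 leaves an expansion of the same shape one size
-- smaller (expand₂Skip₀-suc), while the split-off part is visibly antisymmetric in u and v.
mutual
  expand₂-antisym : ∀ {n} u v (Ψ : (Fin n → Fin (suc (suc n))) → ℤ) → RespectsColumns Ψ →
    expand₂ u v Ψ ≡ - expand₂ v u Ψ
  expand₂-antisym u v Ψ resp = begin
    expand₂ u v Ψ
      ≡⟨ expand₂-split u v Ψ ⟩
    (u zero * expandSkip₀ v Ψ - expandSkip₀ u Ψ * v zero) + expand₂Skip₀ u v Ψ
      ≡⟨ cong (_+_ (u zero * expandSkip₀ v Ψ - expandSkip₀ u Ψ * v zero))
              (expand₂Skip₀-antisym u v Ψ resp) ⟩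
    (u zero * expandSkip₀ v Ψ - expandSkip₀ u Ψ * v zero) + - expand₂Skip₀ v u Ψ
      ≡⟨ swapCross (u zero) (expandSkip₀ v Ψ) (expandSkip₀ u Ψ) (v zero) (expand₂Skip₀ v u Ψ) ⟩
    - ((v zero * expandSkip₀ u Ψ - expandSkip₀ v Ψ * u zero) + expand₂Skip₀ v u Ψ)
      ≡⟨ cong -_ (sym (expand₂-split v u Ψ)) ⟩
    - expand₂ v u Ψ ∎
    where
    open ≡-Reasoning
    swapCross : ∀ a b c d r → (a * b - c * d) + - r ≡ - ((d * c - b * a) + r)
    swapCross = solve-∀

  expand₂Skip₀-antisym : ∀ {n} u v (Ψ : (Fin n → Fin (suc (suc n))) → ℤ) → RespectsColumns Ψ →
    expand₂Skip₀ u v Ψ ≡ - expand₂Skip₀ v u Ψ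
  expand₂Skip₀-antisym {zero} u v Ψ resp = trans (vanish u v) (cong -_ (sym (vanish v u)))
    where
    vanish : ∀ w w′ → expand₂Skip₀ w w′ Ψ ≡ + 0
    vanish w w′ = Σℤ-zero λ j →
      trans (cong (_*_ (- sgn (toℕ j))) (ℤP.*-zeroʳ (w (suc j)))) (ℤP.*-zeroʳ (- sgn (toℕ j)))
  expand₂Skip₀-antisym {suc n} u v Ψ resp = begin
    expand₂Skip₀ u v Ψ
      ≡⟨ expand₂Skip₀-suc u v Ψ resp ⟩
    expand₂ (u ∘ suc) (v ∘ suc) (Ψ ∘ F.lift 1)
      ≡⟨ expand₂-antisym (u ∘ suc) (v ∘ suc) (Ψ ∘ F.lift 1) (resp ∘ lift-cong) ⟩
    - expand₂ (v ∘ suc) (u ∘ suc) (Ψ ∘ F.lift 1)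
      ≡⟨ cong -_ (sym (expand₂Skip₀-suc v u Ψ resp)) ⟩
    - expand₂Skip₀ v u Ψ ∎
    where
    open ≡-Reasoning
    lift-cong : ∀ {σ τ : Fin n → Fin (suc (suc n))} → (∀ b → σ b ≡ τ b) →
      ∀ b → F.lift 1 σ b ≡ F.lift 1 τ b
    lift-cong σ≗τ zero    = refl
    lift-cong σ≗τ (suc b) = cong suc (σ≗τ b)

swapAdjacent : ∀ {n} → Fin n → Fin (suc n) → Fin (suc n)
swapAdjacent zero    zero          = suc zero
swapAdjacent zero    (suc zero)    = zero
swapAdjacent zero    (suc (suc i)) = suc (suc i)
swapAdjacent (suc r) zero          = zero
swapAdjacent (suc r) (suc i)       = suc (swapAdjacent r i)

swapAdjacent-inject₁ : ∀ {n} (r : Fin n) → swapAdjacent r (inject₁ r) ≡ suc r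
swapAdjacent-inject₁ zero    = refl
swapAdjacent-inject₁ (suc r) = cong suc (swapAdjacent-inject₁ r)

swapAdjacent-punchIn : ∀ {n} (r a : Fin n) →
  swapAdjacent r (punchIn (inject₁ r) a) ≡ punchIn (suc r) a
swapAdjacent-punchIn zero    zero    = refl
swapAdjacent-punchIn zero    (suc a) = refl
swapAdjacent-punchIn (suc r) zero    = refl
swapAdjacent-punchIn (suc r) (suc a) = cong suc (swapAdjacent-punchIn r a)

det-swapAdjacent : ∀ {n} (r : Fin n) (M : Matrix (suc n)) → det (M ∘ swapAdjacent r) ≡ - det M
det-swapAdjacent zero M = begin
  det (M ∘ swapAdjacent zero)         ≡⟨ det≡expand₂ (M ∘ swapAdjacent zero) ⟩
  expand₂ (M (suc zero)) (M zero) Ψ   ≡⟨ expand₂-antisym (M (suc zero)) (M zero) Ψ Ψ-resp ⟩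
  - expand₂ (M zero) (M (suc zero)) Ψ ≡⟨ cong -_ (det≡expand₂ M) ⟨
  - det M                             ∎
  where
  open ≡-Reasoning
  Ψ : (Fin _ → Fin _) → ℤ
  Ψ σ = det (λ a b → M (suc (suc a)) (σ b))
  Ψ-resp : RespectsColumns Ψ
  Ψ-resp σ≗τ = det-cong λ a b → cong (M (suc (suc a))) (σ≗τ b)
det-swapAdjacent (suc r) M = trans
  (Σℤ-cong λ j → cong (λ d → sgn (toℕ j) * (M zero j * d)) (det-swapAdjacent r (minor zero j M)))
  (trans (Σℤ-cong λ j → pullNeg (sgn (toℕ j)) (M zero j) (det (minor zero j M)))
         (Σℤ-neg λ j → sgn (toℕ j) * (M zero j * det (minor zero j M))))
  where
  pullNeg : ∀ s a x → s * (a * - x) ≡ - (s * (a * x))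
  pullNeg = solve-∀

i≡-i⇒i≡0 : ∀ {i} → i ≡ - i → i ≡ + 0
i≡-i⇒i≡0 {+ zero}    _  = refl
i≡-i⇒i≡0 {+ suc _}   ()
i≡-i⇒i≡0 {ℤ.-[1+ _ ]} ()

mutual
  det-equalRows : ∀ {n} (M : Matrix n) {i k} → i ≢ k → (∀ j → M i j ≡ M k j) → det M ≡ + 0
  det-equalRows M {zero}  {zero}  0≢0 _     = contradiction refl 0≢0
  det-equalRows M {zero}  {suc k} _   Mi≗Mk = det-equalRows₀ M Mi≗Mk
  det-equalRows M {suc i} {zero}  _   Mi≗Mk = det-equalRows₀ M (sym ∘ Mi≗Mk)
  det-equalRows M {suc i} {suc k} i≢k Mi≗Mk = det-equalRows-suc M (i≢k ∘ cong suc) Mi≗Mk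

  det-equalRows₀ : ∀ {n} (M : Matrix (suc n)) {k} → (∀ j → M zero j ≡ M (suc k) j) → det M ≡ + 0
  det-equalRows₀ M {zero} M₀≗M₁ =
    i≡-i⇒i≡0 (trans (sym (det-cong swap≗id)) (det-swapAdjacent zero M))
    where
    swap≗id : ∀ a b → M (swapAdjacent zero a) b ≡ M a b
    swap≗id zero          b = sym (M₀≗M₁ b)
    swap≗id (suc zero)    b = M₀≗M₁ b
    swap≗id (suc (suc a)) b = refl
  det-equalRows₀ M {suc k} M₀≗Mk = begin
    det M
      ≡⟨ sym (ℤP.neg-involutive (det M)) ⟩
    - - det M
      ≡⟨ cong -_ (sym (det-swapAdjacent zero M)) ⟩
    - det (M ∘ swapAdjacent zero)
      ≡⟨ cong -_ (det-equalRows-suc (M ∘ swapAdjacent zero) {zero} {suc k} (λ ()) M₀≗Mk) ⟩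
    + 0 ∎
    where open ≡-Reasoning

  det-equalRows-suc : ∀ {n} (M : Matrix (suc n)) {i k} → i ≢ k →
    (∀ j → M (suc i) j ≡ M (suc k) j) → det M ≡ + 0
  det-equalRows-suc M i≢k Mi≗Mk = Σℤ-zero λ j → trans
    (cong (λ d → sgn (toℕ j) * (M zero j * d))
          (det-equalRows (minor zero j M) i≢k (Mi≗Mk ∘ punchIn j)))
    (trans (cong (_*_ (sgn (toℕ j))) (ℤP.*-zeroʳ (M zero j))) (ℤP.*-zeroʳ (sgn (toℕ j))))

laplaceTerm : ∀ {n} → Fin (suc n) → Matrix (suc n) → Fin (suc n) → ℤ
laplaceTerm r M j = sgn (toℕ r ℕ.+ toℕ j) * (M r j * det (minor r j M))

rowExpansion : ∀ {n} → Fin (suc n) → Matrix (suc n) → ℤ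
rowExpansion r M = Σℤ (laplaceTerm r M)

rowExpansion-suc : ∀ {n} (r : Fin n) (M : Matrix (suc n)) →
  rowExpansion (suc r) M ≡ - rowExpansion (inject₁ r) (M ∘ swapAdjacent r)
rowExpansion-suc r M = trans (Σℤ-cong term) (Σℤ-neg (laplaceTerm (inject₁ r) (M ∘ swapAdjacent r)))
  where
  term : ∀ j → laplaceTerm (suc r) M j ≡ - laplaceTerm (inject₁ r) (M ∘ swapAdjacent r) j
  term j = trans
    (cong₂ (λ s x → - s * x)
      (cong (λ t → sgn (t ℕ.+ toℕ j)) (sym (FP.toℕ-inject₁ r)))
      (cong₂ _*_ (cong (λ t → M t j) (sym (swapAdjacent-inject₁ r)))
                 (det-cong λ a b → cong (λ t → M t (punchIn j b)) (sym (swapAdjacent-punchIn r a)))))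
    (sym (ℤP.neg-distribˡ-* (sgn (toℕ (inject₁ r) ℕ.+ toℕ j)) _))

rowExpansion-det : ∀ {n} (r : Fin (suc n)) (M : Matrix (suc n)) → rowExpansion r M ≡ det M
rowExpansion-det = <-weakInduction (λ r → ∀ M → rowExpansion r M ≡ det M) (λ _ → refl) fromPrevious
  where
  fromPrevious : ∀ r → (∀ M → rowExpansion (inject₁ r) M ≡ det M) →
    ∀ M → rowExpansion (suc r) M ≡ det M
  fromPrevious r ih M = begin
    rowExpansion (suc r) M                               ≡⟨ rowExpansion-suc r M ⟩
    - rowExpansion (inject₁ r) (M ∘ swapAdjacent r)      ≡⟨ cong -_ (ih (M ∘ swapAdjacent r)) ⟩
    - det (M ∘ swapAdjacent r)                           ≡⟨ cong -_ (det-swapAdjacent r M) ⟩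
    - - det M                                            ≡⟨ ℤP.neg-involutive (det M) ⟩
    det M                                                ∎
    where open ≡-Reasoning

Σ-row-cofactor : ∀ {n} (M : Matrix (suc n)) (i k : Fin (suc n)) →
  Σℤ (λ j → M i j * cofactorMatrix M j k) ≡ det (updateAt M k (const (M i)))
Σ-row-cofactor {n} M i k = trans (Σℤ-cong term) (rowExpansion-det k M′)
  where
  M′ : Matrix (suc n)
  M′ = updateAt M k (const (M i))
  term : ∀ j → M i j * cofactorMatrix M j k ≡ laplaceTerm k M′ j
  term j = trans (reorder (M i j) (sgn (toℕ j ℕ.+ toℕ k)) _)
    (cong₂ _*_ (cong sgn (ℕP.+-comm (toℕ j) (toℕ k)))
      (cong₂ _*_ (cong (λ row → row j) (sym (updateAt-updates k M)))
        (det-cong λ a b → cong (λ row → row (punchIn j b))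
          (sym (updateAt-minimal (punchIn k a) k M (FP.punchInᵢ≢i k a))))))
    where
    reorder : ∀ a s x → a * (s * x) ≡ s * (a * x)
    reorder = solve-∀

·ᵥ-cofactorMatrix : ∀ {n} (M : Matrix n) (v : Fin n → ℤ) i →
  (M ·ᵥ (cofactorMatrix M ·ᵥ v)) i ≡ det M * v i
·ᵥ-cofactorMatrix {suc n} M v i = begin
  Σℤ (λ j → M i j * Σℤ (λ k → C j k * v k))
    ≡⟨ Σℤ-cong (λ j → sym (Σℤ-*ˡ (M i j) (λ k → C j k * v k))) ⟩
  Σℤ (λ j → Σℤ (λ k → M i j * (C j k * v k)))
    ≡⟨ Σℤ-comm (λ j k → M i j * (C j k * v k)) ⟩
  Σℤ (λ k → Σℤ (λ j → M i j * (C j k * v k)))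
    ≡⟨ Σℤ-cong pull-out ⟩
  Σℤ (λ k → Σℤ (λ j → M i j * C j k) * v k)
    ≡⟨ Σℤ-single i _ (λ k k≢i → cong (_* v k) (off-diagonal k (k≢i ∘ sym))) ⟩
  Σℤ (λ j → M i j * C j i) * v i
    ≡⟨ cong (_* v i) diagonal ⟩
  det M * v i ∎
  where
  open ≡-Reasoning
  C : Matrix (suc n)
  C = cofactorMatrix M
  pull-out : ∀ k → Σℤ (λ j → M i j * (C j k * v k)) ≡ Σℤ (λ j → M i j * C j k) * v k
  pull-out k = trans (Σℤ-cong λ j → sym (ℤP.*-assoc (M i j) (C j k) (v k)))
                     (Σℤ-*ʳ (v k) (λ j → M i j * C j k))
  off-diagonal : ∀ k → i ≢ k → Σℤ (λ j → M i j * C j k) ≡ + 0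
  off-diagonal k i≢k = trans (Σ-row-cofactor M i k) (det-equalRows (updateAt M k (const (M i))) i≢k λ j →
    cong (λ row → row j) (trans (updateAt-minimal i k M i≢k) (sym (updateAt-updates k M))))
  diagonal : Σℤ (λ j → M i j * C j i) ≡ det M
  diagonal = trans (Σ-row-cofactor M i i)
    (det-cong λ a b → cong (λ row → row b) (updateAt-id-local i M refl a))

sgn≢0 : ∀ k → sgn k ≢ + 0
sgn≢0 zero    ()
sgn≢0 (suc k) -s≡0 = sgn≢0 k (ℤP.neg-injective -s≡0)

punchIn-fromℕ : ∀ {k} (c : Fin k) → punchIn (fromℕ k) c ≡ inject₁ c
punchIn-fromℕ zero    = refl
punchIn-fromℕ (suc c) = cong suc (punchIn-fromℕ c)

minor-last-leading : ∀ {k n} .(k<n : suc k ℕ.≤ n) (M : Matrix n) a b →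
  minor (fromℕ k) (fromℕ k) (leading k<n M) a b ≡ leading (ℕP.<⇒≤ k<n) M a b
minor-last-leading {k} k<n M a b = cong₂ M (inject≤-punchIn a) (inject≤-punchIn b)
  where
  inject≤-punchIn : ∀ c → inject≤ (punchIn (fromℕ k) c) k<n ≡ inject≤ c (ℕP.<⇒≤ k<n)
  inject≤-punchIn c = FP.toℕ-injective (begin
    toℕ (inject≤ (punchIn (fromℕ k) c) k<n)   ≡⟨ FP.toℕ-inject≤ _ k<n ⟩
    toℕ (punchIn (fromℕ k) c)                  ≡⟨ cong toℕ (punchIn-fromℕ c) ⟩
    toℕ (inject₁ c)                            ≡⟨ FP.toℕ-inject₁ c ⟩
    toℕ c                                      ≡⟨ sym (FP.toℕ-inject≤ c (ℕP.<⇒≤ k<n)) ⟩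
    toℕ (inject≤ c (ℕP.<⇒≤ k<n))              ∎)
    where open ≡-Reasoning

-- If a leading submatrix with trivial kernel were singular, M·C = (det M)·I would force all its
-- cofactors to vanish, in particular the next smaller leading minor; descending this way ends at
-- the empty matrix, whose determinant is 1.
det≢0 : ∀ {n} (M : Matrix n) → (∀ {k} (k≤n : k ℕ.≤ n) → TrivialKernel (leading k≤n M)) →
  det M ≢ + 0
det≢0 {n} M ker detM≡0 = leading≢0 n ℕP.≤-refl
  (trans (det-cong λ i j → cong₂ M (FP.inject≤-refl i _) (FP.inject≤-refl j _)) detM≡0)
  where
  singular⇒minor≡0 : ∀ {k} (P : Matrix (suc k)) → TrivialKernel P → det P ≡ + 0 →
    ∀ i → det (minor i i P) ≡ + 0
  singular⇒minor≡0 P kerP detP≡0 i with ℤP.i*j≡0⇒i≡0∨j≡0 (sgn (toℕ i ℕ.+ toℕ i)) cofactor≡0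
    where
    cofactor≡0 : cofactorMatrix P i i ≡ + 0
    cofactor≡0 = trans (sym (·ᵥ-δ (cofactorMatrix P) i i))
      (kerP (cofactorMatrix P ·ᵥ λ k → + δ k i) P·C·eᵢ≡0 i)
      where
      P·C·eᵢ≡0 : ∀ a → (P ·ᵥ (cofactorMatrix P ·ᵥ λ k → + δ k i)) a ≡ + 0
      P·C·eᵢ≡0 a = trans (·ᵥ-cofactorMatrix P (λ k → + δ k i) a)
        (trans (cong (_* + δ a i) detP≡0) (ℤP.*-zeroˡ (+ δ a i)))
  ... | inj₁ sgn≡0 = contradiction sgn≡0 (sgn≢0 (toℕ i ℕ.+ toℕ i))
  ... | inj₂ det≡0 = det≡0
  leading≢0 : ∀ k (k≤n : k ℕ.≤ n) → det (leading k≤n M) ≢ + 0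
  leading≢0 zero    _   ()
  leading≢0 (suc k) k<n det≡0 = leading≢0 k (ℕP.<⇒≤ k<n)
    (trans (sym (det-cong (minor-last-leading k<n M)))
           (singular⇒minor≡0 (leading k<n M) (ker k<n) det≡0 (fromℕ k)))

Solvable : ∀ {n} → Matrix n → (Fin n → ℤ) → Set
Solvable M w = Σ (Fin _ → ℤ) λ τ → ∀ i → w i ≡ (M ·ᵥ τ) i

solvable⇒det∣cofactor·ᵥ : ∀ {n} (M : Matrix n) → TrivialKernel M → ∀ w → Solvable M w →
  ∀ i → det M ℤ∣.∣ (cofactorMatrix M ·ᵥ w) i
solvable⇒det∣cofactor·ᵥ {n} M ker w (τ , w≡Mτ) i = ℤ∣.divides (τ i)
  (trans (ℤP.i-j≡0⇒i≡j _ _ (ker difference M·difference≡0 i)) (ℤP.*-comm (det M) (τ i)))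
  where
  difference : Fin n → ℤ
  difference j = (cofactorMatrix M ·ᵥ w) j - det M * τ j
  M·difference≡0 : ∀ a → (M ·ᵥ difference) a ≡ + 0
  M·difference≡0 a = begin
    (M ·ᵥ difference) a
      ≡⟨ ·ᵥ-sub M (cofactorMatrix M ·ᵥ w) (λ j → det M * τ j) a ⟩
    (M ·ᵥ (cofactorMatrix M ·ᵥ w)) a - (M ·ᵥ (λ j → det M * τ j)) a
      ≡⟨ cong₂ _-_ (·ᵥ-cofactorMatrix M w a) (·ᵥ-scale M (det M) τ a) ⟩
    det M * w a - det M * (M ·ᵥ τ) a
      ≡⟨ cong (λ x → det M * w a - det M * x) (sym (w≡Mτ a)) ⟩
    det M * w a - det M * w a
      ≡⟨ ℤP.+-inverseʳ (det M * w a) ⟩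
    + 0 ∎
    where open ≡-Reasoning

det∣cofactor·ᵥ⇒solvable : ∀ {n} (M : Matrix n) → det M ≢ + 0 → ∀ w →
  (∀ i → det M ℤ∣.∣ (cofactorMatrix M ·ᵥ w) i) → Solvable M w
det∣cofactor·ᵥ⇒solvable {n} M detM≢0 w det∣ = τ , λ i → ℤP.*-cancelˡ-≡ (det M) _ _ (begin
    det M * w i                           ≡⟨ sym (·ᵥ-cofactorMatrix M w i) ⟩
    (M ·ᵥ (cofactorMatrix M ·ᵥ w)) i      ≡⟨ ·ᵥ-congʳ M C·w≡det·τ i ⟩
    (M ·ᵥ (λ j → det M * τ j)) i          ≡⟨ ·ᵥ-scale M (det M) τ i ⟩
    det M * (M ·ᵥ τ) i                    ∎)
  where
  open ≡-Reasoning
  instance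
    _ : ℤ.NonZero (det M)
    _ = ℤ.≢-nonZero detM≢0
  τ : Fin n → ℤ
  τ j = ℤ∣.quotient (det∣ j)
  C·w≡det·τ : ∀ j → (cofactorMatrix M ·ᵥ w) j ≡ det M * τ j
  C·w≡det·τ j = trans (ℤ∣._∣_.equality (det∣ j)) (ℤP.*-comm (τ j) (det M))

-- The Laplacian and the maximum principle

module _ {n} (G : Multigraph n) where

  laplacian-·ᵥ : ∀ X i → (laplacian G ·ᵥ X) i ≡ Σℤ (λ j → + adj G i j * (X i - X j))
  laplacian-·ᵥ X i = begin
    Σℤ (λ j → (diagonal j - + adj G i j) * X j)
      ≡⟨ Σℤ-cong (λ j → distribute (diagonal j) (+ adj G i j) (X j)) ⟩
    Σℤ (λ j → diagonal j * X j + - (+ adj G i j * X j))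
      ≡⟨ Σℤ-+ (λ j → diagonal j * X j) (λ j → - (+ adj G i j * X j)) ⟩
    Σℤ (λ j → diagonal j * X j) + Σℤ (λ j → - (+ adj G i j * X j))
      ≡⟨ cong (_+ Σℤ (λ j → - (+ adj G i j * X j))) diagonal-part ⟩
    Σℤ (λ j → + adj G i j * X i) + Σℤ (λ j → - (+ adj G i j * X j))
      ≡⟨ sym (Σℤ-+ (λ j → + adj G i j * X i) (λ j → - (+ adj G i j * X j))) ⟩
    Σℤ (λ j → + adj G i j * X i + - (+ adj G i j * X j))
      ≡⟨ Σℤ-cong (λ j → factor (+ adj G i j) (X i) (X j)) ⟩
    Σℤ (λ j → + adj G i j * (X i - X j)) ∎
    where
    open ≡-Reasoning
    diagonal : Fin n → ℤ
    diagonal j = + (δ i j ℕ.* valency G i)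
    distribute : ∀ d a x → (d - a) * x ≡ d * x + - (a * x)
    distribute = solve-∀
    factor : ∀ a x y → a * x + - (a * y) ≡ a * (x - y)
    factor = solve-∀
    off-diagonal : ∀ {j} → j ≢ i → δ i j ℕ.* valency G i ≡ 0
    off-diagonal j≢i = cong (ℕ._* valency G i) (δ-≢ (j≢i ∘ sym))
    diagonal-part : Σℤ (λ j → diagonal j * X j) ≡ Σℤ (λ j → + adj G i j * X i)
    diagonal-part = begin
      Σℤ (λ j → diagonal j * X j)
        ≡⟨ Σℤ-single i _ (λ j j≢i → cong (λ d → + d * X j) (off-diagonal j≢i)) ⟩
      diagonal i * X i
        ≡⟨ cong (λ d → + (d ℕ.* valency G i) * X i) (δ-refl i) ⟩
      + (valency G i ℕ.+ 0) * X i
        ≡⟨ cong (λ v → + v * X i) (ℕP.+-identityʳ (valency G i)) ⟩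
      + valency G i * X i
        ≡⟨ cong (_* X i) (+-Σℕ (adj G i)) ⟩
      Σℤ (λ j → + adj G i j) * X i
        ≡⟨ sym (Σℤ-*ʳ (X i) (λ j → + adj G i j)) ⟩
      Σℤ (λ j → + adj G i j * X i) ∎

  laplacian-·ᵥ-const : ∀ c i → (laplacian G ·ᵥ (λ _ → c)) i ≡ + 0
  laplacian-·ᵥ-const c i = trans (laplacian-·ᵥ (λ _ → c) i)
    (Σℤ-zero λ j → trans (cong (_*_ (+ adj G i j)) (ℤP.+-inverseʳ c)) (ℤP.*-zeroʳ (+ adj G i j)))

  laplacian-sym : ∀ i j → laplacian G i j ≡ laplacian G j i
  laplacian-sym i j with i F.≟ j
  ... | yes refl = refl
  ... | no  i≢j  = cong₂ (λ d a → + d - + a)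
    (trans (cong (ℕ._* valency G i) (δ-≢ i≢j)) (cong (ℕ._* valency G j) (sym (δ-≢ (i≢j ∘ sym)))))
    (symmetric G i j)

  Σ-laplacian-column : ∀ j → Σℤ (λ i → laplacian G i j) ≡ + 0
  Σ-laplacian-column j = begin
    Σℤ (λ i → laplacian G i j)
      ≡⟨ Σℤ-cong (λ i → trans (laplacian-sym i j) (sym (ℤP.*-identityʳ (laplacian G j i)))) ⟩
    (laplacian G ·ᵥ (λ _ → + 1)) j
      ≡⟨ laplacian-·ᵥ-const (+ 1) j ⟩
    + 0 ∎
    where open ≡-Reasoning

  Σ-laplacian-·ᵥ : ∀ σ → Σℤ (laplacian G ·ᵥ σ) ≡ + 0
  Σ-laplacian-·ᵥ σ = trans (Σℤ-comm (λ i j → laplacian G i j * σ j))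
    (Σℤ-zero λ j → trans (Σℤ-*ʳ (σ j) (λ i → laplacian G i j))
                         (trans (cong (_* σ j) (Σ-laplacian-column j)) (ℤP.*-zeroˡ (σ j))))

argmax : ∀ {n} (X : Fin (suc n) → ℤ) → Σ (Fin (suc n)) λ w₀ → ∀ w → X w ≤ X w₀
argmax {zero}  X = zero , λ { zero → ℤP.≤-refl }
argmax {suc n} X with argmax (X ∘ suc)
... | w₁ , X≤Xw₁ with X zero ℤ.≤? X (suc w₁)
...   | yes X₀≤ = suc w₁ , λ { zero → X₀≤ ; (suc w) → X≤Xw₁ w }
...   | no  X₀≰ = zero , λ { zero → ℤP.≤-refl
                           ; (suc w) → ℤP.≤-trans (X≤Xw₁ w) (ℤP.<⇒≤ (ℤP.≰⇒> X₀≰)) }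

module _ {n} (G : Multigraph n) where

  HarmonicOn : (Fin n → Set) → (Fin n → ℤ) → Set
  HarmonicOn U X = ∀ w → U w → (laplacian G ·ᵥ X) w ≡ + 0

  VanishesOff : (Fin n → Set) → (Fin n → ℤ) → Set
  VanishesOff U X = ∀ w → ¬ U w → X w ≡ + 0

  maximum-spreads : ∀ (X : Fin n → ℤ) j → (∀ l → X l ≤ X j) → (laplacian G ·ᵥ X) j ≡ + 0 →
    ∀ {k} → 0 ℕ.< adj G j k → X k ≡ X j
  maximum-spreads X j X≤Xj harmonic {k} 0<ajk
    with ℤP.i*j≡0⇒i≡0∨j≡0 (+ adj G j k)
           (Σℤ-nonneg≡0 term term≥0 (trans (sym (laplacian-·ᵥ G X j)) harmonic) k)
    where
    term : Fin n → ℤ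
    term l = + adj G j l * (X j - X l)
    term≥0 : ∀ l → + 0 ≤ term l
    term≥0 l = ℤP.≤-trans (ℤP.≤-reflexive (sym (ℤP.*-zeroʳ (+ adj G j l))))
                          (ℤP.*-monoˡ-≤-nonNeg (+ adj G j l) (ℤP.i≤j⇒0≤j-i (X≤Xj l)))
  ... | inj₁ ajk≡0 = contradiction (ℤP.+-injective ajk≡0) (ℕP.>⇒≢ 0<ajk)
  ... | inj₂ Xj-Xk≡0 = sym (ℤP.i-j≡0⇒i≡j (X j) (X k) Xj-Xk≡0)

module _ {m} (G : Multigraph (suc m)) (connected : Connected G)
         (U : Fin (suc m) → Set) (U? : ∀ w → Dec (U w)) {o : Fin (suc m)} (o∉U : ¬ U o) where

  harmonicOn⇒≤0 : ∀ X → VanishesOff G U X → HarmonicOn G U X → ∀ w → X w ≤ + 0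
  harmonicOn⇒≤0 X X≡0-off harmonic w with argmax X
  ... | w₀ , X≤Xw₀ with X w₀ ℤ.≤? + 0
  ...   | yes max≤0 = ℤP.≤-trans (X≤Xw₀ w) max≤0
  ...   | no  max≰0 =
    contradiction (trans (sym (X≡0-off o o∉U)) (constant (connected w₀ o))) (ℤP.<⇒≢ 0<max)
    where
    0<max : + 0 < X w₀
    0<max = ℤP.≰⇒> max≰0
    constant : ∀ {v} → Reachable G w₀ v → X v ≡ X w₀
    constant here                   = refl
    constant (step {j} path 0<ajk) = trans (maximum-spreads G X j X≤Xj (harmonic j j∈U) 0<ajk) Xj≡max
      where
      Xj≡max : X j ≡ X w₀
      Xj≡max = constant path
      X≤Xj : ∀ l → X l ≤ X j
      X≤Xj l = subst (X l ≤_) (sym Xj≡max) (X≤Xw₀ l)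
      j∈U : U j
      j∈U with U? j
      ... | yes j∈U = j∈U
      ... | no  j∉U = contradiction (trans (sym (X≡0-off j j∉U)) Xj≡max) (ℤP.<⇒≢ 0<max)

  harmonicOn⇒≡0 : ∀ X → VanishesOff G U X → HarmonicOn G U X → ∀ w → X w ≡ + 0
  harmonicOn⇒≡0 X X≡0-off harmonic w = ℤP.≤-antisym (harmonicOn⇒≤0 X X≡0-off harmonic w)
    (ℤP.neg-cancel-≤ (harmonicOn⇒≤0 (λ v → - X v) -X≡0-off -harmonic w))
    where
    -X≡0-off : VanishesOff G U (λ v → - X v)
    -X≡0-off v v∉U = cong -_ (X≡0-off v v∉U)
    -harmonic : HarmonicOn G U (λ v → - X v)
    -harmonic v v∈U = trans (·ᵥ-neg (laplacian G) X v) (cong -_ (harmonic v v∈U))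

-- The reduced Laplacian

inject₁≡inject≤ : ∀ {n} (i : Fin n) → inject₁ i ≡ inject≤ i (ℕP.n≤1+n n)
inject₁≡inject≤ zero    = refl
inject₁≡inject≤ (suc i) = cong suc (inject₁≡inject≤ i)

module _ {m} (G : Multigraph (suc m)) (connected : Connected G) where

  TrivialKernel-leading-laplacian : ∀ {k} (k≤m : k ℕ.≤ m) →
    TrivialKernel (leading (ℕP.m≤n⇒m≤1+n k≤m) (laplacian G))
  TrivialKernel-leading-laplacian {k} k≤m x Px≡0 i = begin
    x i                         ≡⟨ padZero-inject≤ k≤1+m x i ⟨
    padZero x (inject≤ i k≤1+m) ≡⟨ harmonicOn⇒≡0 G connected U (λ w → toℕ w ℕ.<? k) last∉U
                                     (padZero x) vanishes harmonic (inject≤ i k≤1+m) ⟩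
    + 0                         ∎
    where
    open ≡-Reasoning
    k≤1+m : k ℕ.≤ suc m
    k≤1+m = ℕP.m≤n⇒m≤1+n k≤m
    U : Fin (suc m) → Set
    U w = toℕ w ℕ.< k
    last∉U : ¬ U (fromℕ m)
    last∉U m<k = ℕP.<⇒≱ (subst (ℕ._< k) (FP.toℕ-fromℕ m) m<k) k≤m
    vanishes : VanishesOff G U (padZero x)
    vanishes w w∉U = padZero-≥ x w (ℕP.≮⇒≥ w∉U)
    harmonic : HarmonicOn G U (padZero x)
    harmonic w w<k = begin
      (laplacian G ·ᵥ padZero x) w             ≡⟨ cong (laplacian G ·ᵥ padZero x) w≡ ⟩
      (laplacian G ·ᵥ padZero x) (inject≤ w′ k≤1+m) ≡⟨ leading-·ᵥ k≤1+m (laplacian G) x w′ ⟨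
      (leading k≤1+m (laplacian G) ·ᵥ x) w′    ≡⟨ Px≡0 w′ ⟩
      + 0                                      ∎
      where
      w′ : Fin k
      w′ = F.fromℕ< w<k
      w≡ : w ≡ inject≤ w′ k≤1+m
      w≡ = FP.toℕ-injective (sym (trans (FP.toℕ-inject≤ w′ k≤1+m) (FP.toℕ-fromℕ< w<k)))

  leading-reducedLaplacian : ∀ {k} (k≤m : k ℕ.≤ m) i j →
    leading (ℕP.m≤n⇒m≤1+n k≤m) (laplacian G) i j ≡ leading k≤m (reducedLaplacian G) i j
  leading-reducedLaplacian k≤m i j = sym (cong₂ (laplacian G) (inject₁-inject≤ i) (inject₁-inject≤ j))
    where
    inject₁-inject≤ : ∀ c → inject₁ (inject≤ c k≤m) ≡ inject≤ c (ℕP.m≤n⇒m≤1+n k≤m)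
    inject₁-inject≤ c = trans (inject₁≡inject≤ (inject≤ c k≤m)) (FP.inject≤-idempotent c k≤m _ _)

  det-reducedLaplacian≢0 : det (reducedLaplacian G) ≢ + 0
  det-reducedLaplacian≢0 = det≢0 (reducedLaplacian G) λ k≤m →
    TrivialKernel-cong (leading-reducedLaplacian k≤m) (TrivialKernel-leading-laplacian k≤m)

  TrivialKernel-reducedLaplacian : TrivialKernel (reducedLaplacian G)
  TrivialKernel-reducedLaplacian =
    TrivialKernel-cong leading≗L̃ (TrivialKernel-leading-laplacian ℕP.≤-refl)
    where
    leading≗L̃ : ∀ i j → leading (ℕP.n≤1+n m) (laplacian G) i j ≡ reducedLaplacian G i j
    leading≗L̃ i j = trans (leading-reducedLaplacian ℕP.≤-refl i j)
      (cong₂ (reducedLaplacian G) (FP.inject≤-refl i _) (FP.inject≤-refl j _))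

data InitOrLast {m} : Fin (suc m) → Set where
  init : ∀ i → InitOrLast (inject₁ i)
  last : InitOrLast (fromℕ m)

initOrLast : ∀ {m} (w : Fin (suc m)) → InitOrLast w
initOrLast {zero}  zero    = last
initOrLast {suc m} zero    = init zero
initOrLast {suc m} (suc w) with initOrLast w
... | init i = init (suc i)
... | last   = last

module _ {m} (G : Multigraph (suc m)) where

  laplacian-·ᵥ-inject₁ : ∀ σ → σ (fromℕ m) ≡ + 0 →
    ∀ i → (laplacian G ·ᵥ σ) (inject₁ i) ≡ (reducedLaplacian G ·ᵥ (σ ∘ inject₁)) i
  laplacian-·ᵥ-inject₁ σ σ-last≡0 i = begin
    (laplacian G ·ᵥ σ) (inject₁ i)
      ≡⟨ Σℤ-init-last (λ w → laplacian G (inject₁ i) w * σ w) ⟩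
    (reducedLaplacian G ·ᵥ (σ ∘ inject₁)) i + Lᵢₙ * σ (fromℕ m)
      ≡⟨ cong (λ x → (reducedLaplacian G ·ᵥ (σ ∘ inject₁)) i + Lᵢₙ * x) σ-last≡0 ⟩
    (reducedLaplacian G ·ᵥ (σ ∘ inject₁)) i + Lᵢₙ * + 0
      ≡⟨ cong (_+_ ((reducedLaplacian G ·ᵥ (σ ∘ inject₁)) i)) (ℤP.*-zeroʳ Lᵢₙ) ⟩
    (reducedLaplacian G ·ᵥ (σ ∘ inject₁)) i + + 0
      ≡⟨ ℤP.+-identityʳ _ ⟩
    (reducedLaplacian G ·ᵥ (σ ∘ inject₁)) i ∎
    where
    open ≡-Reasoning
    Lᵢₙ : ℤ
    Lᵢₙ = laplacian G (inject₁ i) (fromℕ m)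

  principal⇒reducedSolvable : ∀ E → IsPrincipal G E → Solvable (reducedLaplacian G) (reduce E)
  principal⇒reducedSolvable E (σ , E≡Lσ) = shifted ∘ inject₁ , λ i → begin
    E (inject₁ i)
      ≡⟨ E≡Lσ (inject₁ i) ⟩
    (laplacian G ·ᵥ σ) (inject₁ i)
      ≡⟨ ℤP.+-identityʳ _ ⟨
    (laplacian G ·ᵥ σ) (inject₁ i) - + 0
      ≡⟨ cong (_-_ ((laplacian G ·ᵥ σ) (inject₁ i))) (laplacian-·ᵥ-const G σₙ (inject₁ i)) ⟨
    (laplacian G ·ᵥ σ) (inject₁ i) - (laplacian G ·ᵥ (λ _ → σₙ)) (inject₁ i)
      ≡⟨ ·ᵥ-sub (laplacian G) σ (λ _ → σₙ) (inject₁ i) ⟨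
    (laplacian G ·ᵥ shifted) (inject₁ i)
      ≡⟨ laplacian-·ᵥ-inject₁ shifted (ℤP.+-inverseʳ σₙ) i ⟩
    (reducedLaplacian G ·ᵥ (shifted ∘ inject₁)) i ∎
    where
    open ≡-Reasoning
    σₙ : ℤ
    σₙ = σ (fromℕ m)
    shifted : Fin (suc m) → ℤ
    shifted w = σ w - σₙ

  reducedSolvable⇒principal : ∀ E → IsDegreeZero E → Solvable (reducedLaplacian G) (reduce E) →
    IsPrincipal G E
  reducedSolvable⇒principal E ΣE≡0 (τ , Ẽ≡L̃τ) = σ , E≡Lσ
    where
    σ : Fin (suc m) → ℤ
    σ = padZero τ
    σ-inject₁ : ∀ j → σ (inject₁ j) ≡ τ j
    σ-inject₁ j = trans (cong σ (inject₁≡inject≤ j)) (padZero-inject≤ (ℕP.n≤1+n m) τ j)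
    σ-last : σ (fromℕ m) ≡ + 0
    σ-last = padZero-≥ τ (fromℕ m) (ℕP.≤-reflexive (sym (FP.toℕ-fromℕ m)))
    E≡Lσ-init : ∀ i → E (inject₁ i) ≡ (laplacian G ·ᵥ σ) (inject₁ i)
    E≡Lσ-init i = trans (Ẽ≡L̃τ i)
      (sym (trans (laplacian-·ᵥ-inject₁ σ σ-last i) (·ᵥ-congʳ (reducedLaplacian G) σ-inject₁ i)))
    E≡Lσ-last : E (fromℕ m) ≡ (laplacian G ·ᵥ σ) (fromℕ m)
    E≡Lσ-last = +-cancelˡ (Σℤ (E ∘ inject₁)) _ _ (begin
      Σℤ (E ∘ inject₁) + E (fromℕ m)
        ≡⟨ Σℤ-init-last E ⟨
      Σℤ E
        ≡⟨ trans ΣE≡0 (sym (Σ-laplacian-·ᵥ G σ)) ⟩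
      Σℤ (laplacian G ·ᵥ σ)
        ≡⟨ Σℤ-init-last (laplacian G ·ᵥ σ) ⟩
      Σℤ ((laplacian G ·ᵥ σ) ∘ inject₁) + (laplacian G ·ᵥ σ) (fromℕ m)
        ≡⟨ cong (_+ (laplacian G ·ᵥ σ) (fromℕ m)) (Σℤ-cong E≡Lσ-init) ⟨
      Σℤ (E ∘ inject₁) + (laplacian G ·ᵥ σ) (fromℕ m) ∎)
      where open ≡-Reasoning
    E≡Lσ : ∀ w → E w ≡ (laplacian G ·ᵥ σ) w
    E≡Lσ w with initOrLast w
    ... | init i = E≡Lσ-init i
    ... | last   = E≡Lσ-last

-- Divisibility and the order of a divisor class

gcdWith∣∣d∣ : ∀ {n} (v : Fin n → ℤ) d → gcdWith v d ∣ ∣ d ∣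
gcdWith∣∣d∣ {zero}  v d = ℕ∣.∣-refl
gcdWith∣∣d∣ {suc n} v d =
  ℕ∣.∣-trans (gcd[m,n]∣n ∣ v zero ∣ (gcdWith (v ∘ suc) d)) (gcdWith∣∣d∣ (v ∘ suc) d)

gcdWith∣∣v∣ : ∀ {n} (v : Fin n → ℤ) d i → gcdWith v d ∣ ∣ v i ∣
gcdWith∣∣v∣ {suc n} v d zero    = gcd[m,n]∣m ∣ v zero ∣ (gcdWith (v ∘ suc) d)
gcdWith∣∣v∣ {suc n} v d (suc i) =
  ℕ∣.∣-trans (gcd[m,n]∣n ∣ v zero ∣ (gcdWith (v ∘ suc) d)) (gcdWith∣∣v∣ (v ∘ suc) d i)

*-gcdWith-greatest : ∀ {n} (v : Fin n → ℤ) d {a} k →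
  (∀ i → a ∣ k ℕ.* ∣ v i ∣) → a ∣ k ℕ.* ∣ d ∣ → a ∣ k ℕ.* gcdWith v d
*-gcdWith-greatest {zero}  v d k a∣kv a∣kd = a∣kd
*-gcdWith-greatest {suc n} v d k a∣kv a∣kd =
  subst (_ ∣_) (sym (c*gcd[m,n]≡gcd[cm,cn] k ∣ v zero ∣ (gcdWith (v ∘ suc) d)))
    (gcd-greatest (a∣kv zero) (*-gcdWith-greatest (v ∘ suc) d k (a∣kv ∘ suc) a∣kd))

∣-*-entries⇔∣-*-gcdWith : ∀ {n} (v : Fin n → ℤ) d k →
  (∀ i → ∣ d ∣ ∣ k ℕ.* ∣ v i ∣) ⇔ ∣ d ∣ ∣ k ℕ.* gcdWith v d
∣-*-entries⇔∣-*-gcdWith v d k = mk⇔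
  (λ d∣kv → *-gcdWith-greatest v d k d∣kv (ℕ∣.n∣m*n k))
  (λ d∣kg i → ℕ∣.∣-trans d∣kg (ℕ∣.*-monoʳ-∣ k (gcdWith∣∣v∣ v d i)))

div-∣⇔∣-* : ∀ {a g} k → a ≢ 0 → g ∣ a → ((a div g) ∣ k) ⇔ (a ∣ k ℕ.* g)
div-∣⇔∣-* {a} {zero}   k a≢0 0∣a = contradiction (ℕ∣.0∣⇒≡0 0∣a) a≢0
div-∣⇔∣-* {a} {suc g′} k a≢0 g∣a = mk⇔
  (λ K∣k → subst (_∣ k ℕ.* g) (DM.m/n*n≡m g∣a) (ℕ∣.*-monoˡ-∣ g K∣k))
  (λ a∣kg → ℕ∣.*-cancelʳ-∣ g (subst (_∣ k ℕ.* g) (sym (DM.m/n*n≡m g∣a)) a∣kg))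
  where
  g : ℕ
  g = suc g′

0<div : ∀ {a g} → a ≢ 0 → g ∣ a → 0 ℕ.< a div g
0<div {a} {zero}   a≢0 0∣a = contradiction (ℕ∣.0∣⇒≡0 0∣a) a≢0
0<div {a} {suc g′} a≢0 g∣a = ℕP.n≢0⇒n>0 λ a/g≡0 →
  a≢0 (trans (sym (DM.m/n*n≡m g∣a)) (cong (ℕ._* suc g′) a/g≡0))

∣+k*⇔∣k*∣ : ∀ a k x → a ℤ∣.∣ (+ k * x) ⇔ (∣ a ∣ ∣ k ℕ.* ∣ x ∣)
∣+k*⇔∣k*∣ a k x = mk⇔
  (λ a∣kx → subst (∣ a ∣ ∣_) (ℤP.abs-* (+ k) x) (ℤ∣.∣⇒∣ᵤ a∣kx))
  (λ a∣kx → ℤ∣.∣ᵤ⇒∣ (subst (∣ a ∣ ∣_) (sym (ℤP.abs-* (+ k) x)) a∣kx))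

Π-cong-⇔ : ∀ {n} {P Q : Fin n → Set} → (∀ i → P i ⇔ Q i) → (∀ i → P i) ⇔ (∀ i → Q i)
Π-cong-⇔ P⇔Q =
  mk⇔ (λ p i → Equivalence.to (P⇔Q i) (p i)) (λ q i → Equivalence.from (P⇔Q i) (q i))

∣·ᵥ-scale⇔∣-* : ∀ {n} (M : Matrix n) (x : Fin n → ℤ) a k →
  (∀ i → a ℤ∣.∣ (M ·ᵥ (λ j → + k * x j)) i) ⇔ (∀ i → ∣ a ∣ ∣ k ℕ.* ∣ (M ·ᵥ x) i ∣)
∣·ᵥ-scale⇔∣-* M x a k = Π-cong-⇔ λ i →
  subst (λ y → a ℤ∣.∣ y ⇔ (∣ a ∣ ∣ k ℕ.* ∣ (M ·ᵥ x) i ∣))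
        (sym (·ᵥ-scale M (+ k) x i)) (∣+k*⇔∣k*∣ a k ((M ·ᵥ x) i))

OrderInJac-from-∣ : ∀ {n} (G : Multigraph n) (D : Divisor n) {K} → 0 ℕ.< K →
  (∀ k → IsPrincipal G (scale k D) ⇔ (K ∣ k)) → OrderInJac G D K
OrderInJac-from-∣ G D {K} 0<K principal⇔K∣ =
  0<K , Equivalence.from (principal⇔K∣ K) ℕ∣.∣-refl , minimal
  where
  minimal : ∀ j → 0 ℕ.< j → j ℕ.< K → ¬ IsPrincipal G (scale j D)
  minimal j 0<j j<K jD-principal =
    ℕP.<⇒≱ j<K (ℕ∣.∣⇒≤ {{ℕ.>-nonZero 0<j}} (Equivalence.to (principal⇔K∣ j) jD-principal))

IsDegreeZero-scale : ∀ {n} k (D : Divisor n) → IsDegreeZero D → IsDegreeZero (scale k D)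
IsDegreeZero-scale k D ΣD≡0 =
  trans (Σℤ-*ˡ (+ k) D) (trans (cong (_*_ (+ k)) ΣD≡0) (ℤP.*-zeroʳ (+ k)))

corollary3p2 : ∀ (m : ℕ) (G : Multigraph (suc m)) → Connected G →
                   (D : Divisor (suc m)) → IsDegreeZero D →
                   OrderInJac G D
                     (∣ det (reducedLaplacian G) ∣
                       div gcdWith (cofactorMatrix (reducedLaplacian G) ·ᵥ reduce D)
                                   (det (reducedLaplacian G)))
corollary3p2 m G connected D deg0 = OrderInJac-from-∣ G D 0<K principal⇔K∣
  where
  L̃ : Matrix m
  L̃ = reducedLaplacian G
  d : ℤ
  d = det L̃
  c : Fin m → ℤ
  c = cofactorMatrix L̃ ·ᵥ reduce D
  g : ℕ
  g = gcdWith c d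
  |d|≢0 : ∣ d ∣ ≢ 0
  |d|≢0 = det-reducedLaplacian≢0 G connected ∘ ℤP.∣i∣≡0⇒i≡0
  0<K : 0 ℕ.< ∣ d ∣ div g
  0<K = 0<div |d|≢0 (gcdWith∣∣d∣ c d)
  principal⇔K∣ : ∀ k → IsPrincipal G (scale k D) ⇔ ((∣ d ∣ div g) ∣ k)
  principal⇔K∣ k = begin
    IsPrincipal G (scale k D)
      ≈⟨ mk⇔ (principal⇒reducedSolvable G (scale k D))
             (reducedSolvable⇒principal G (scale k D) (IsDegreeZero-scale k D deg0)) ⟩
    Solvable L̃ (reduce (scale k D))
      ≈⟨ mk⇔ (solvable⇒det∣cofactor·ᵥ L̃ (TrivialKernel-reducedLaplacian G connected) _)
             (det∣cofactor·ᵥ⇒solvable L̃ (det-reducedLaplacian≢0 G connected) _) ⟩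
    (∀ i → d ℤ∣.∣ (cofactorMatrix L̃ ·ᵥ reduce (scale k D)) i)
      ≈⟨ ∣·ᵥ-scale⇔∣-* (cofactorMatrix L̃) (reduce D) d k ⟩
    (∀ i → ∣ d ∣ ∣ k ℕ.* ∣ c i ∣)
      ≈⟨ ∣-*-entries⇔∣-*-gcdWith c d k ⟩
    (∣ d ∣ ∣ k ℕ.* g)
      ≈⟨ ⇔-sym (div-∣⇔∣-* k |d|≢0 (gcdWith∣∣d∣ c d)) ⟩
    ((∣ d ∣ div g) ∣ k) ∎
    where open SetoidReasoning (⇔-setoid 0ℓ)
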